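{- Let $n$ be a positive integer and let $J\subseteq[n]=\{1,\dots,n\}$ be an arithmetic progression with common difference $1$ or $2$ and $|J|=m\ge 2$. Let $T\subseteq J$ with $|T|\ge (m+1)/2$. If $x$ is an integer with at most one odd prime factor, then there is $y\in T$ such that $x$ and $y$ are 2-coprime.
   Context: Two integers are 2-coprime if no prime other than $2$ divides both of them. -}

module Defs where

open import Data.Nat using (ℕ; _+_; _*_; _<_; _≤_)
open import Data.Nat.Primality using (Prime)
open import Data.Integer using (ℤ; +_)
open import Data.Integer.Divisibility using (_∣_)
open import Data.Product using (∃-syntax; _×_)
open import Relation.Binary.PropositionalEquality using (_≡_)
open import Relation.Nullary using (¬_)
import Data.Nat.Divisibility as ℕD

OddPrime : ℕ → Set
OddPrime p = Prime p × ¬ (2 ℕD.∣ p)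

AtMostOneOddPrimeFactor : ℤ → Set
AtMostOneOddPrimeFactor x =
  ∀ p q → OddPrime p → OddPrime q → (+ p) ∣ x → (+ q) ∣ x → p ≡ q

TwoCoprime : ℤ → ℤ → Set
TwoCoprime a b = ∀ p → Prime p → (+ p) ∣ a → (+ p) ∣ b → p ≡ 2

InAP : ℕ → ℕ → ℕ → ℕ → Set
InAP a d m y = ∃[ i ] (i < m × y ≡ a + i * d)

-- Two terms a + i d and a + j d of the progression differ by (j − i) d, and when
-- 0 < j − i ≤ 2 and d ≤ 2 no odd prime divides this difference; so an odd prime p divides at
-- most one term in each block {3k, 3k+1, 3k+2} of indices. The m indices fall into at most
-- ⌈m/3⌉ < (m + 1)/2 ≤ |T| blocks, so by pigeonhole p does not divide some y ∈ T. If p is the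
-- only odd prime factor of x, such a y is 2-coprime to x; if x has no odd prime factor, every
-- y is.
module Submission where

open import Defs
open import Data.Nat using (ℕ; _+_; _*_; _∸_; _≤_; _<_; _≥_)
open import Data.Integer using (ℤ; +_)
open import Data.List using (List; length)
open import Data.List.Relation.Unary.All using (All)
open import Data.List.Relation.Unary.Unique.Propositional using (Unique)
open import Data.List.Membership.Propositional using (_∈_)
open import Data.Product using (∃-syntax; _×_)
open import Data.Sum using (_⊎_)
open import Relation.Binary.PropositionalEquality using (_≡_)

open import Level using (Level)
open import Data.Nat using (zero; suc; z≤n; s≤s; NonZero; _/_; _%_; nonTrivial⇒n>1)
open import Data.Nat.Properties
open import Data.Nat.DivMod using (m≡m%n+[m/n]*n; m%n<n; m/n*n≤m; m<n*o⇒m/o<n)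
open import Data.Nat.Divisibility as ℕ using (∣⇒≤; ∣m+n∣m⇒∣n; _∣?_; _∣0)
open import Data.Nat.Primality using (Prime; prime?; euclidsLemma; prime⇒irreducible; prime⇒nonTrivial)
open import Data.Integer using (∣_∣)
open import Data.Integer.Divisibility using (_∣_)
open import Data.Fin as Fin using (Fin; fromℕ<)
open import Data.Fin.Properties using (pigeonhole; fromℕ<-injective)
open import Data.List using (_∷_; []; map; lookup)
open import Data.List.Relation.Unary.All as All using ([]; _∷_)
import Data.List.Relation.Unary.All.Properties as All
open import Data.List.Relation.Unary.AllPairs using (_∷_)
open import Data.List.Relation.Unary.Any using (here)
import Data.List.Relation.Unary.Unique.Propositional.Properties as Unique
open import Data.List.Membership.Propositional using (find)
open import Data.List.Membership.Propositional.Properties using (∈-lookup)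
open import Data.List.Properties using (length-map)
open import Data.Product using (_,_; ∃₂; proj₁)
open import Data.Sum using (inj₁; inj₂)
open import Relation.Nullary using (¬_; Dec; yes; no; ¬?; _×-dec_; contradiction)
open import Relation.Nullary.Decidable using (from-yes; map′)
open import Relation.Unary using (Decidable)
open import Relation.Binary.PropositionalEquality using (_≢_; refl; sym; cong; subst; module ≡-Reasoning)
open import Relation.Binary using (tri<; tri≈; tri>)
open import Data.Nat.Tactic.RingSolver using (solve-∀)

private
  variable
    ℓ : Level
    A : Set ℓ
    a d i j k m p : ℕ

oddPrime? : Decidable OddPrime
oddPrime? p = prime? p ×-dec ¬? (2 ∣? p)

even-prime⇒≡2 : Prime p → 2 ℕ.∣ p → p ≡ 2
even-prime⇒≡2 pp 2∣p with prime⇒irreducible pp 2∣p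
... | inj₂ 2≡p = sym 2≡p

oddPrime∤≤2 : OddPrime p → 1 ≤ k → k ≤ 2 → ¬ p ℕ.∣ k
oddPrime∤≤2 {p} (pp , 2∤p) (s≤s z≤n) k≤2 p∣k = 2∤p (subst (2 ℕ.∣_) (sym p≡2) ℕ.∣-refl)
  where
  p≡2 : p ≡ 2
  p≡2 = ≤-antisym (≤-trans (∣⇒≤ p∣k) k≤2) (nonTrivial⇒n>1 p {{prime⇒nonTrivial pp}})

∣ap∧∣ap⇒∣[j∸i]*d : i ≤ j → p ℕ.∣ a + i * d → p ℕ.∣ a + j * d → p ℕ.∣ (j ∸ i) * d
∣ap∧∣ap⇒∣[j∸i]*d {i} {j} {p} {a} {d} i≤j p∣aᵢ p∣aⱼ = ∣m+n∣m⇒∣n (subst (p ℕ.∣_) aⱼ≡aᵢ+[j∸i]d p∣aⱼ) p∣aᵢ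
  where
  open ≡-Reasoning
  aⱼ≡aᵢ+[j∸i]d : a + j * d ≡ (a + i * d) + (j ∸ i) * d
  aⱼ≡aᵢ+[j∸i]d = begin
    a + j * d                 ≡⟨ cong (λ t → a + t * d) (m+[n∸m]≡n i≤j) ⟨
    a + (i + (j ∸ i)) * d     ≡⟨ cong (λ t → a + t) (*-distribʳ-+ d i (j ∸ i)) ⟩
    a + (i * d + (j ∸ i) * d) ≡⟨ +-assoc a (i * d) ((j ∸ i) * d) ⟨
    (a + i * d) + (j ∸ i) * d ∎

m/n≡o/n⇒o<m+n : ∀ {m o} n .{{_ : NonZero n}} → m / n ≡ o / n → o < m + n
m/n≡o/n⇒o<m+n {m} {o} n m/n≡o/n = begin-strict
  o                   ≡⟨ m≡m%n+[m/n]*n o n ⟩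
  o % n + (o / n) * n <⟨ +-monoˡ-< ((o / n) * n) (m%n<n o n) ⟩
  n + (o / n) * n     ≡⟨ cong (λ t → n + t * n) m/n≡o/n ⟨
  n + (m / n) * n     ≤⟨ +-monoʳ-≤ n (m/n*n≤m m n) ⟩
  n + m               ≡⟨ +-comm n m ⟩
  m + n               ∎
  where open ≤-Reasoning

oddPrime∤ap-near : OddPrime p → d ≡ 1 ⊎ d ≡ 2 → i < j → j < i + 3 →
                   p ℕ.∣ a + i * d → ¬ p ℕ.∣ a + j * d
oddPrime∤ap-near {p} {d} {i} {j} op d∈ i<j j<i+3 p∣aᵢ p∣aⱼ
  with euclidsLemma (j ∸ i) d (proj₁ op) (∣ap∧∣ap⇒∣[j∸i]*d (<⇒≤ i<j) p∣aᵢ p∣aⱼ)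
... | inj₁ p∣j∸i = oddPrime∤≤2 op (m<n⇒0<n∸m i<j) j∸i≤2 p∣j∸i
  where
  j∸i≤2 : j ∸ i ≤ 2
  j∸i≤2 = subst (j ∸ i ≤_) (m+n∸m≡n i 2) (∸-monoˡ-≤ i (≤-pred (subst (j <_) (+-suc i 2) j<i+3)))
... | inj₂ p∣d with d∈
...   | inj₁ refl = oddPrime∤≤2 op ≤-refl (s≤s z≤n) p∣d
...   | inj₂ refl = oddPrime∤≤2 op (s≤s z≤n) ≤-refl p∣d

oddPrime∤ap-sameBlock : OddPrime p → d ≡ 1 ⊎ d ≡ 2 → i ≢ j → i / 3 ≡ j / 3 →
                        p ℕ.∣ a + i * d → ¬ p ℕ.∣ a + j * d
oddPrime∤ap-sameBlock {i = i} {j} op d∈ i≢j i/3≡j/3 p∣aᵢ p∣aⱼ with <-cmp i j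
... | tri< i<j _ _ = oddPrime∤ap-near op d∈ i<j (m/n≡o/n⇒o<m+n 3 i/3≡j/3) p∣aᵢ p∣aⱼ
... | tri≈ _ i≡j _ = i≢j i≡j
... | tri> _ _ j<i = oddPrime∤ap-near op d∈ j<i (m/n≡o/n⇒o<m+n 3 (sym i/3≡j/3)) p∣aⱼ p∣aᵢ

Unique⇒lookup-injective : {xs : List A} → Unique xs →
                          (i j : Fin (length xs)) → i Fin.< j → lookup xs i ≢ lookup xs j
Unique⇒lookup-injective {xs = _ ∷ _} (x≢xs ∷ _) Fin.zero (Fin.suc j) _ = All.lookup x≢xs (∈-lookup j)
Unique⇒lookup-injective {xs = _ ∷ _} (_ ∷ xs!) (Fin.suc i) (Fin.suc j) (s≤s i<j) =
  Unique⇒lookup-injective xs! i j i<j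

Unique-pigeonhole : {xs : List A} (f : A → ℕ) → Unique xs → All (λ x → f x < k) xs →
                    k < length xs → ∃₂ λ x y → x ∈ xs × y ∈ xs × x ≢ y × f x ≡ f y
Unique-pigeonhole {xs = xs} f xs! f<k k<∣xs∣ =
  let i , j , i<j , gᵢ≡gⱼ = pigeonhole k<∣xs∣ g
  in  lookup xs i , lookup xs j , ∈-lookup i , ∈-lookup j ,
      Unique⇒lookup-injective xs! i j i<j , fromℕ<-injective _ _ _ _ gᵢ≡gⱼ
  where
  g : Fin (length xs) → Fin _
  g i = fromℕ< (All.lookup f<k (∈-lookup i))

m+1≤2*L⇒∃k<L∧m≤k*3 : ∀ L → 2 ≤ m → m + 1 ≤ 2 * L → ∃[ k ] (k < L × m ≤ k * 3)
m+1≤2*L⇒∃k<L∧m≤k*3 zero          2≤m m+1≤0 = contradiction (≤-trans m+1≤0 z≤n) (<⇒≱ (+-monoˡ-≤ 1 2≤m))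
m+1≤2*L⇒∃k<L∧m≤k*3 (suc zero)    2≤m m+1≤2 = contradiction m+1≤2 (<⇒≱ (+-monoˡ-≤ 1 2≤m))
m+1≤2*L⇒∃k<L∧m≤k*3 {m} (suc (suc l)) _ m+1≤2L = suc l , ≤-refl , m≤[1+l]*3
  where
  2*[2+l]≡3+l*2+1 : ∀ l → 2 * suc (suc l) ≡ 3 + l * 2 + 1
  2*[2+l]≡3+l*2+1 = solve-∀
  m≤[1+l]*3 : m ≤ suc l * 3
  m≤[1+l]*3 = ≤-trans (+-cancelʳ-≤ 1 m _ (subst (m + 1 ≤_) (2*[2+l]≡3+l*2+1 l) m+1≤2L))
                      (+-monoʳ-≤ 3 (*-monoʳ-≤ l (s≤s (s≤s z≤n))))

All-InAP⇒≡map : {T : List ℕ} → All (InAP a d m) T →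
                ∃[ is ] (All (_< m) is × T ≡ map (λ i → a + i * d) is)
All-InAP⇒≡map [] = [] , [] , refl
All-InAP⇒≡map ((i , i<m , refl) ∷ apT) =
  let is , is<m , T≡ = All-InAP⇒≡map apT in i ∷ is , i<m ∷ is<m , cong (_ ∷_) T≡

oddPrime∤all-ap : OddPrime p → d ≡ 1 ⊎ d ≡ 2 → m ≤ k * 3 →
                  {is : List ℕ} → Unique is → All (_< m) is → k < length is →
                  ¬ All (λ i → p ℕ.∣ a + i * d) is
oddPrime∤all-ap op d∈ m≤k*3 is! is<m k<∣is∣ p∣ap =
  let i , j , i∈ , j∈ , i≢j , i/3≡j/3 = Unique-pigeonhole (_/ 3) is! blocks<k k<∣is∣
  in  oddPrime∤ap-sameBlock op d∈ i≢j i/3≡j/3 (All.lookup p∣ap i∈) (All.lookup p∣ap j∈)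
  where
  blocks<k = All.map (λ i<m → m<n*o⇒m/o<n (<-≤-trans i<m m≤k*3)) is<m

oddPrime∤some-ap : OddPrime p → d ≡ 1 ⊎ d ≡ 2 → m ≤ k * 3 →
                   {T : List ℕ} → Unique T → All (InAP a d m) T → k < length T →
                   ∃[ y ] (y ∈ T × ¬ p ℕ.∣ y)
oddPrime∤some-ap {p} {k = k} op d∈ m≤k*3 {T} T! apT k<∣T∣ with All-InAP⇒≡map apT
... | is , is<m , refl = find (All.¬All⇒Any¬ (p ∣?_) T ¬p∣T)
  where
  ¬p∣T : ¬ All (p ℕ.∣_) T
  ¬p∣T p∣T = oddPrime∤all-ap op d∈ m≤k*3 (Unique.map⁻ T!) is<m
               (subst (k <_) (length-map _ is) k<∣T∣) (All.map⁻ p∣T)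

oddPrimeFactor? : (x : ℤ) → Dec (∃[ p ] (OddPrime p × + p ∣ x))
-- + p ∣ x unfolds to p ∣ ∣ x ∣, so the with abstracts it as well.
oddPrimeFactor? x with ∣ x ∣
... | zero  = yes (3 , from-yes (oddPrime? 3) , 3 ∣0)
... | suc n = map′ (λ (p , _ , P) → p , P) (λ (p , op , p∣) → p , s≤s (∣⇒≤ p∣) , op , p∣)
                   (anyUpTo? (λ p → oddPrime? p ×-dec p ∣? suc n) (suc (suc n)))

noCommonOddPrime⇒TwoCoprime : ∀ {x y} → (∀ q → OddPrime q → + q ∣ x → ¬ + q ∣ y) → TwoCoprime x y
noCommonOddPrime⇒TwoCoprime coprime q pq q∣x q∣y with 2 ∣? q
... | yes 2∣q = even-prime⇒≡2 pq 2∣q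
... | no  2∤q = contradiction q∣y (coprime q (pq , 2∤q) q∣x)

<length⇒∃∈ : {xs : List A} → k < length xs → ∃[ x ] x ∈ xs
<length⇒∃∈ {xs = x ∷ _} _ = x , here refl

claim4p2 : (n a d m : ℕ) → 1 ≤ n → (d ≡ 1 ⊎ d ≡ 2) → m ≥ 2
    → 1 ≤ a → a + (m ∸ 1) * d ≤ n
    → (T : List ℕ) → Unique T → All (InAP a d m) T
    → m + 1 ≤ 2 * length T
    → (x : ℤ) → AtMostOneOddPrimeFactor x
    → ∃[ y ] (y ∈ T × TwoCoprime x (+ y))
claim4p2 _ _ _ _ _ d∈ 2≤m _ _ T T! apT m+1≤2∣T∣ x atMostOne
  with m+1≤2*L⇒∃k<L∧m≤k*3 (length T) 2≤m m+1≤2∣T∣ | oddPrimeFactor? x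
... | k , k<∣T∣ , m≤k*3 | yes (p , op , p∣x) =
  let y , y∈T , p∤y = oddPrime∤some-ap op d∈ m≤k*3 T! apT k<∣T∣
  in  y , y∈T , noCommonOddPrime⇒TwoCoprime {x} {+ y} λ q oq q∣x →
        subst (λ r → ¬ + r ∣ + y) (atMostOne p q op oq p∣x q∣x) p∤y
... | k , k<∣T∣ , _ | no ∄p =
  let y , y∈T = <length⇒∃∈ k<∣T∣
  in  y , y∈T , noCommonOddPrime⇒TwoCoprime {x} {+ y} λ q oq q∣x _ → ∄p (q , oq , q∣x)
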